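{- Consider the following game for an integer $n\ge 2$. A codemaker secretly chooses a permutation $y=(y_1,\dots,y_n)$ of $\{1,\dots,n\}$ (written in one-line notation). A codebreaker repeatedly submits queries, each of which must itself be a permutation $x=(x_1,\dots,x_n)$ of $\{1,\dots,n\}$, and after each query receives the answer $\mathrm{black}(x,y)=|\{i\in\{1,\dots,n\} : x_i=y_i\}|$. The codebreaker may choose each query depending on the answers to all previous queries. Then there is a constant $C>0$ such that for every $n\ge 2$ the codebreaker has a deterministic adaptive strategy that determines the secret permutation $y$ (for every possible $y$) using at most $C\, n\log_2 n$ queries; that is, the secret code can be identified in $O(n\log_2 n)$ queries.
   Context: This is the Black-Peg Mastermind variant with $k=n$ colors and no color repetition allowed either in the secret code or in the queries ("Permutation Mastermind"). Only the black information (number of positions where query and secret agree) is returned. -}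

module Defs where

open import Data.Nat using (ℕ; zero; suc; _+_)
open import Data.Fin using (Fin)
open import Data.Fin.Properties using (_≟_)
open import Data.List using (length; filter; allFin)
open import Relation.Binary.PropositionalEquality using (_≡_)
open import Data.Fin.Permutation using (Permutation′; _⟨$⟩ʳ_)

-- A code / query: a permutation of {1..n}, i.e. of Fin n (one-line notation: i ↦ π ⟨$⟩ʳ i).
Code : ℕ → Set
Code n = Permutation′ n

black : ∀ {n} → Code n → Code n → ℕ
black {n} x y = length (filter (λ i → x ⟨$⟩ʳ i ≟ y ⟨$⟩ʳ i) (allFin n))

-- A deterministic adaptive strategy of the codebreaker, as a decision tree:
-- either stop and announce a code, or submit a query (itself a permutation)
-- and continue depending on the black answer.
data Strategy (n : ℕ) : Set where
  announce : Code n → Strategy n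
  ask      : Code n → (ℕ → Strategy n) → Strategy n

result : ∀ {n} → Strategy n → Code n → Code n
result (announce z) y = z
result (ask x k)    y = result (k (black x y)) y

queries : ∀ {n} → Strategy n → Code n → ℕ
queries (announce z) y = 0
queries (ask x k)    y = suc (queries (k (black x y)) y)

_≗ᶜ_ : ∀ {n} → Code n → Code n → Set
_≗ᶜ_ {n} x y = (i : Fin n) → x ⟨$⟩ʳ i ≡ y ⟨$⟩ʳ i

module Submission where

-- Identify positions and values with ℤ/N.  Position q of the secret y lies in class c when
-- y q = q + c; the query "shift by c" is answered by the size of class c, and the N class sizes
-- add up to N.  If class t - 1 is empty and class t is not, a binary search over the rotations
-- of the shift by t - 1 finds, with ⌈log₂ N⌉ queries, a position of class t, or else the
-- position holding the value t - 1; both readings are pursued, and the first is checked by one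
-- more query.  From then on a known value anchors every search, so the classes can be emptied
-- one after the other: a shift query either shows that the current class has no unknown
-- position left, or is followed by a binary search locating a new one.  At most 2N such rounds
-- of 1 + ⌈log₂ N⌉ queries determine y.  If no class is empty, every class has exactly one
-- position; exchanging the values 0 and 1 destroys this, and the same procedure succeeds on the
-- relabelled secret.

open import Defs
open import Data.Bool using (if_then_else_)
open import Data.Empty using (⊥-elim)
open import Data.Fin using (Fin; zero; suc; punchIn; punchOut; toℕ)
import Data.Fin.Permutation as Perm
open import Data.Fin.Permutation
  using (_⟨$⟩ʳ_; _⟨$⟩ˡ_; inverseˡ; inverseʳ; _∘ₚ_; flip; transpose; permutation)
open import Data.Fin.Properties
  using (_≟_; any?; all?; punchInᵢ≢i; punchIn-punchOut; toℕ-injective; toℕ-fromℕ<; toℕ<n)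
open import Data.List using (length; filter; tabulate)
open import Data.Maybe using (Maybe; just; nothing; fromMaybe; maybe′)
import Data.Maybe.Properties as Maybe
open import Data.Nat
  using (ℕ; zero; suc; _+_; _*_; _∸_; _≤_; _<_; _≥_; z≤n; s≤s; z<s; ⌊_/2⌋; ⌈_/2⌉; _≤?_; _<?_; _≡ᵇ_)
open import Data.Nat.DivMod
  using (_%_; _mod_; m%n<n; m<n⇒m%n≡m; %-distribˡ-+; m%n%n≡m%n; [m+kn]%n≡m%n; [m+n]%n≡m%n)
open import Data.Nat.Logarithm using (⌈log₂_⌉; ⌈log₂⌉-mono-≤; ⌈log₂⌈n/2⌉⌉≡⌈log₂n⌉∸1)
open import Data.Nat.Properties hiding (_≟_)
open import Data.Nat.Properties using () renaming (_≟_ to _≟ℕ_)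
open import Data.Nat.Tactic.RingSolver using (solve-∀)
open import Algebra.Properties.CommutativeMonoid.Sum +-0-commutativeMonoid
  using (sum; sum-syntax; sum-cong-≗; sum-replicate-zero; sum-remove; ∑-comm; ∑-distrib-+; ∑-permute)
open import Data.Product using (Σ; ∃; _×_; _,_; proj₁; proj₂)
open import Data.Sum as Sum using (_⊎_; inj₁; inj₂)
open import Data.Vec as Vec using (Vec; []; _∷_)
open import Data.Vec.Functional using (updateAt)
open import Data.Vec.Functional.Properties using (updateAt-updates; updateAt-minimal)
open import Data.Vec.Properties using (lookup∘tabulate)
open import Function using (_∘_; case_of_; Injection)
open import Function.Properties.Inverse using (↔⇒↣)
open import Relation.Binary.PropositionalEquality
  using (_≡_; _≢_; refl; sym; trans; cong; cong₂; subst; module ≡-Reasoning)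
open import Relation.Nullary using (Dec; yes; no; ¬_)
open import Relation.Nullary.Decidable using (_×-dec_)
open import Relation.Unary using (Pred; Decidable)

-- Counting

∑-term-≤ : ∀ {n} (f : Fin n → ℕ) i → f i ≤ sum f
∑-term-≤ {suc n} f i = ≤-trans (m≤m+n (f i) _) (≤-reflexive (sym (sum-remove {i = i} f)))

∑-two-terms-≤ : ∀ {n} (f : Fin n → ℕ) {i j} → i ≢ j → f i + f j ≤ sum f
∑-two-terms-≤ {suc n} f {i} {j} i≢j = begin
  f i + f j                          ≡⟨ cong (λ k → f i + f k) (punchIn-punchOut i≢j) ⟨
  f i + f (punchIn i (punchOut i≢j)) ≤⟨ +-monoʳ-≤ (f i) (∑-term-≤ (f ∘ punchIn i) (punchOut i≢j)) ⟩
  f i + sum (f ∘ punchIn i)          ≡⟨ sum-remove f ⟨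
  sum f                              ∎
  where open ≤-Reasoning

∑-mono-≤ : ∀ {n} {f g : Fin n → ℕ} → (∀ i → f i ≤ g i) → sum f ≤ sum g
∑-mono-≤ {zero}  f≤g = z≤n
∑-mono-≤ {suc n} f≤g = +-mono-≤ (f≤g zero) (∑-mono-≤ (f≤g ∘ suc))

∑-const-1 : ∀ n → ∑[ i < n ] 1 ≡ n
∑-const-1 zero    = refl
∑-const-1 (suc n) = cong suc (∑-const-1 n)

∑-positive : ∀ {n} (f : Fin n → ℕ) → 0 < sum f → ∃ λ i → 0 < f i
∑-positive {suc n} f pos with f zero in eq
... | suc _ = zero , subst (0 <_) (sym eq) z<s
... | zero  = let i , fi>0 = ∑-positive (f ∘ suc) pos in suc i , fi>0

∑-≤-≡ : ∀ {n} {f g : Fin n → ℕ} → (∀ i → f i ≤ g i) → sum f ≡ sum g → ∀ i → f i ≡ g i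
∑-≤-≡ {suc n} {f} {g} f≤g ∑f≡∑g i = ≤-antisym (f≤g i) (+-cancelʳ-≤ _ (g i) (f i) (begin
  g i + sum (g ∘ punchIn i) ≡⟨ sum-remove g ⟨
  sum g                     ≡⟨ ∑f≡∑g ⟨
  sum f                     ≡⟨ sum-remove f ⟩
  f i + sum (f ∘ punchIn i) ≤⟨ +-monoʳ-≤ (f i) (∑-mono-≤ (f≤g ∘ punchIn i)) ⟩
  f i + sum (g ∘ punchIn i) ∎))
  where open ≤-Reasoning

∑-update : ∀ {n} (f g : Fin n → ℕ) i → (∀ j → j ≢ i → f j ≡ g j) → sum f + g i ≡ sum g + f i
∑-update {suc n} f g i agree = begin
  sum f + g i                     ≡⟨ cong (_+ g i) (sum-remove f) ⟩
  f i + sum (f ∘ punchIn i) + g i ≡⟨ cong (λ s → f i + s + g i) (sum-cong-≗ (λ k → agree _ (punchInᵢ≢i i k))) ⟩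
  f i + sum (g ∘ punchIn i) + g i ≡⟨ +-comm (f i + _) (g i) ⟩
  g i + (f i + sum (g ∘ punchIn i)) ≡⟨ cong (g i +_) (+-comm (f i) _) ⟩
  g i + (sum (g ∘ punchIn i) + f i) ≡⟨ +-assoc (g i) _ (f i) ⟨
  g i + sum (g ∘ punchIn i) + f i ≡⟨ cong (_+ f i) (sum-remove g) ⟨
  sum g + f i                     ∎
  where open ≡-Reasoning

∑-update₂ : ∀ {n} (f g : Fin n → ℕ) i j → i ≢ j → (∀ k → k ≢ i → k ≢ j → f k ≡ g k) →
            sum f + (g i + g j) ≡ sum g + (f i + f j)
∑-update₂ f g i j i≢j agree = begin
  sum f + (g i + g j) ≡⟨ cong (λ x → sum f + (x + g j)) (updateAt-updates i f) ⟨
  sum f + (h i + g j) ≡⟨ +-assoc (sum f) (h i) (g j) ⟨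
  sum f + h i + g j   ≡⟨ cong (_+ g j) (∑-update f h i (λ k k≢i → sym (updateAt-minimal k i f k≢i))) ⟩
  sum h + f i + g j   ≡⟨ swap (sum h) (f i) (g j) ⟩
  sum h + g j + f i   ≡⟨ cong (_+ f i) (∑-update h g j h≈g) ⟩
  sum g + h j + f i   ≡⟨ swap (sum g) (h j) (f i) ⟩
  sum g + f i + h j   ≡⟨ +-assoc (sum g) (f i) (h j) ⟩
  sum g + (f i + h j) ≡⟨ cong (λ x → sum g + (f i + x)) (updateAt-minimal j i f (i≢j ∘ sym)) ⟩
  sum g + (f i + f j) ∎
  where
  open ≡-Reasoning
  swap : ∀ a b c → a + b + c ≡ a + c + b
  swap = solve-∀
  h : Fin _ → ℕ
  h = updateAt f i (λ _ → g i)
  h≈g : ∀ k → k ≢ j → h k ≡ g k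
  h≈g k k≢j with k ≟ i
  ... | yes refl = updateAt-updates i f
  ... | no  k≢i  = trans (updateAt-minimal k i f k≢i) (agree k k≢i k≢j)

indicator : ∀ {p} {P : Set p} → Dec P → ℕ
indicator (yes _) = 1
indicator (no _)  = 0

module _ {p} {P : Set p} where

  indicator≤1 : (P? : Dec P) → indicator P? ≤ 1
  indicator≤1 (yes _) = s≤s z≤n
  indicator≤1 (no _)  = z≤n

  indicator-yes : (P? : Dec P) → P → indicator P? ≡ 1
  indicator-yes (yes _)  _  = refl
  indicator-yes (no ¬p) p = ⊥-elim (¬p p)

  indicator-no : (P? : Dec P) → ¬ P → indicator P? ≡ 0
  indicator-no (yes p) ¬p = ⊥-elim (¬p p)
  indicator-no (no _)  _  = refl

  indicator>0⇒ : (P? : Dec P) → 0 < indicator P? → P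
  indicator>0⇒ (yes p) _ = p

  indicator+-positive : (P? : Dec P) → ∀ {k} → 0 < indicator P? + k → P ⊎ 0 < k
  indicator+-positive (yes p) _   = inj₁ p
  indicator+-positive (no _)  0<k = inj₂ 0<k

indicator-cong : ∀ {p q} {P : Set p} {Q : Set q} (P? : Dec P) (Q? : Dec Q) →
                 (P → Q) → (Q → P) → indicator P? ≡ indicator Q?
indicator-cong (yes _) (yes _) _   _   = refl
indicator-cong (yes p) (no ¬q) p⇒q _   = ⊥-elim (¬q (p⇒q p))
indicator-cong (no ¬p) (yes q) _   q⇒p = ⊥-elim (¬p (q⇒p q))
indicator-cong (no _)  (no _)  _   _   = refl

count : ∀ {n p} {P : Pred (Fin n) p} → Decidable P → ℕ
count {n} P? = ∑[ i < n ] indicator (P? i)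

module _ {n p} {P : Pred (Fin n) p} (P? : Decidable P) where

  count-cong : ∀ {q} {Q : Pred (Fin n) q} (Q? : Decidable Q) →
               (∀ i → P i → Q i) → (∀ i → Q i → P i) → count P? ≡ count Q?
  count-cong Q? P⇒Q Q⇒P = sum-cong-≗ (λ i → indicator-cong (P? i) (Q? i) (P⇒Q i) (Q⇒P i))

  count≤n : count P? ≤ n
  count≤n = ≤-trans (∑-mono-≤ (λ i → indicator≤1 (P? i))) (≤-reflexive (∑-const-1 n))

  count-positive : ∀ {i} → P i → 0 < count P?
  count-positive {i} pᵢ = ≤-trans (≤-reflexive (sym (indicator-yes (P? i) pᵢ))) (∑-term-≤ _ i)

  count≥2 : ∀ {i j} → i ≢ j → P i → P j → 2 ≤ count P?
  count≥2 {i} {j} i≢j pᵢ pⱼ = begin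
    2                                     ≡⟨ cong₂ _+_ (indicator-yes (P? i) pᵢ) (indicator-yes (P? j) pⱼ) ⟨
    indicator (P? i) + indicator (P? j)   ≤⟨ ∑-two-terms-≤ _ i≢j ⟩
    count P?                              ∎
    where open ≤-Reasoning

  count-none : (∀ i → ¬ P i) → count P? ≡ 0
  count-none none = trans (sum-cong-≗ (λ i → indicator-no (P? i) (none i))) (sum-replicate-zero n)

  count≡0⇒ : count P? ≡ 0 → ∀ i → ¬ P i
  count≡0⇒ c≡0 i pᵢ = <⇒≢ (count-positive pᵢ) (sym c≡0)

  count>0⇒ : 0 < count P? → ∃ P
  count>0⇒ c>0 = let i , iᵢ>0 = ∑-positive _ c>0 in i , indicator>0⇒ (P? i) iᵢ>0

  count≡n⇒ : count P? ≡ n → ∀ i → P i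
  count≡n⇒ c≡n i = indicator>0⇒ (P? i) (≤-reflexive (sym
    (∑-≤-≡ (λ i → indicator≤1 (P? i)) (trans c≡n (sym (∑-const-1 n))) i)))

  ∀⇒count≡n : (∀ i → P i) → count P? ≡ n
  ∀⇒count≡n all = trans (sum-cong-≗ (λ i → indicator-yes (P? i) (all i))) (∑-const-1 n)

count-singleton : ∀ {n} (v : Fin n) → count (_≟ v) ≡ 1
count-singleton {n} v = begin
  count (_≟ v)                     ≡⟨ +-identityʳ _ ⟨
  count (_≟ v) + 0                 ≡⟨ ∑-update (λ w → indicator (w ≟ v)) (λ _ → 0) v (λ w → indicator-no (w ≟ v)) ⟩
  ∑[ i < n ] 0 + indicator (v ≟ v) ≡⟨ cong₂ _+_ (sum-replicate-zero n) (indicator-yes (v ≟ v) refl) ⟩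
  1                                ∎
  where open ≡-Reasoning

length-filter-tabulate : ∀ {a p} {A : Set a} {P : Pred A p} (P? : Decidable P) {n} (g : Fin n → A) →
                         length (filter P? (tabulate g)) ≡ ∑[ i < n ] indicator (P? (g i))
length-filter-tabulate P? {zero}  g = refl
length-filter-tabulate P? {suc n} g with P? (g zero)
... | yes _ = cong suc (length-filter-tabulate P? (g ∘ suc))
... | no  _ = length-filter-tabulate P? (g ∘ suc)

module _ {n : ℕ} where

  ⟨$⟩ʳ-injective : (σ : Code n) {u v : Fin n} → σ ⟨$⟩ʳ u ≡ σ ⟨$⟩ʳ v → u ≡ v
  ⟨$⟩ʳ-injective σ = Injection.injective (↔⇒↣ σ)

  agreeAt? : (x y : Code n) → Decidable (λ i → x ⟨$⟩ʳ i ≡ y ⟨$⟩ʳ i)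
  agreeAt? x y i = x ⟨$⟩ʳ i ≟ y ⟨$⟩ʳ i

  black≡count : (x y : Code n) → black x y ≡ count (agreeAt? x y)
  black≡count x y = length-filter-tabulate (agreeAt? x y) (λ i → i)

  black-cong : {x x′ y y′ : Code n} → x ≗ᶜ x′ → y ≗ᶜ y′ → black x y ≡ black x′ y′
  black-cong {x} {x′} {y} {y′} x≗x′ y≗y′ = begin
    black x y                ≡⟨ black≡count x y ⟩
    count (agreeAt? x y)     ≡⟨ count-cong (agreeAt? x y) (agreeAt? x′ y′)
                                   (λ i eq → trans (sym (x≗x′ i)) (trans eq (y≗y′ i)))
                                   (λ i eq → trans (x≗x′ i) (trans eq (sym (y≗y′ i)))) ⟩
    count (agreeAt? x′ y′)   ≡⟨ black≡count x′ y′ ⟨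
    black x′ y′              ∎
    where open ≡-Reasoning

  black≡n⇒≗ : (x y : Code n) → black x y ≡ n → x ≗ᶜ y
  black≡n⇒≗ x y b≡n = count≡n⇒ (agreeAt? x y) (trans (sym (black≡count x y)) b≡n)

  ≗⇒black≡n : (x y : Code n) → x ≗ᶜ y → black x y ≡ n
  ≗⇒black≡n x y x≗y = trans (black≡count x y) (∀⇒count≡n (agreeAt? x y) x≗y)

  black-∘ₚ : (x y σ : Code n) → black (x ∘ₚ σ) (y ∘ₚ σ) ≡ black x y
  black-∘ₚ x y σ = begin
    black (x ∘ₚ σ) (y ∘ₚ σ)            ≡⟨ black≡count (x ∘ₚ σ) (y ∘ₚ σ) ⟩
    count (agreeAt? (x ∘ₚ σ) (y ∘ₚ σ)) ≡⟨ count-cong (agreeAt? (x ∘ₚ σ) (y ∘ₚ σ)) (agreeAt? x y)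
                                            (λ _ → ⟨$⟩ʳ-injective σ) (λ _ → cong (σ ⟨$⟩ʳ_)) ⟩
    count (agreeAt? x y)               ≡⟨ black≡count x y ⟨
    black x y                          ∎
    where open ≡-Reasoning

  black-relabel : (x y σ : Code n) → black (x ∘ₚ σ) y ≡ black x (y ∘ₚ flip σ)
  black-relabel x y σ =
    trans (black-cong {x = x ∘ₚ σ} {x ∘ₚ σ} {y} {(y ∘ₚ flip σ) ∘ₚ σ} (λ _ → refl) (λ _ → sym (inverseʳ σ)))
          (black-∘ₚ x (y ∘ₚ flip σ) σ)

-- Query programs

if?_then_else_ : ∀ {p a} {P : Set p} {A : Set a} → Dec P → A → A → A
if? yes _ then x else y = x
if? no  _ then x else y = y

data Program (n : ℕ) (A : Set) : Set where
  return : A → Program n A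
  query  : Code n → (ℕ → Program n A) → Program n A

module _ {n : ℕ} where

  run : ∀ {A} → Program n A → Code n → A
  run (return a)  y = a
  run (query x k) y = run (k (black x y)) y

  cost : ∀ {A} → Program n A → Code n → ℕ
  cost (return a)  y = 0
  cost (query x k) y = suc (cost (k (black x y)) y)

  infixl 1 _>>=_
  _>>=_ : ∀ {A B} → Program n A → (A → Program n B) → Program n B
  return a  >>= f = f a
  query x k >>= f = query x (λ b → k b >>= f)

  run->>= : ∀ {A B} (p : Program n A) (f : A → Program n B) y → run (p >>= f) y ≡ run (f (run p y)) y
  run->>= (return a)  f y = refl
  run->>= (query x k) f y = run->>= (k (black x y)) f y

  cost->>= : ∀ {A B} (p : Program n A) (f : A → Program n B) y →
             cost (p >>= f) y ≡ cost p y + cost (f (run p y)) y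
  cost->>= (return a)  f y = refl
  cost->>= (query x k) f y = cong suc (cost->>= (k (black x y)) f y)

  relabel : ∀ {A} → Code n → Program n A → Program n A
  relabel σ (return a)  = return a
  relabel σ (query x k) = query (x ∘ₚ σ) (relabel σ ∘ k)

  run-relabel : ∀ {A} σ (p : Program n A) y → run (relabel σ p) y ≡ run p (y ∘ₚ flip σ)
  run-relabel σ (return a)  y = refl
  run-relabel σ (query x k) y rewrite black-relabel x y σ = run-relabel σ (k _) y

  cost-relabel : ∀ {A} σ (p : Program n A) y → cost (relabel σ p) y ≡ cost p (y ∘ₚ flip σ)
  cost-relabel σ (return a)  y = refl
  cost-relabel σ (query x k) y rewrite black-relabel x y σ = cong suc (cost-relabel σ (k _) y)

submit : ∀ {n} → Code n → Program n ℕ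
submit x = query x return

strategy : ∀ {n} → Program n (Code n) → Strategy n
strategy (return z)  = announce z
strategy (query x k) = ask x (strategy ∘ k)

result-strategy : ∀ {n} (p : Program n (Code n)) y → result (strategy p) y ≡ run p y
result-strategy (return z)  y = refl
result-strategy (query x k) y = result-strategy (k (black x y)) y

queries-strategy : ∀ {n} (p : Program n (Code n)) y → queries (strategy p) y ≡ cost p y
queries-strategy (return z)  y = refl
queries-strategy (query x k) y = cong suc (queries-strategy (k (black x y)) y)

module _ {n : ℕ} where

  submitAll : ∀ {k} → (Fin k → Code n) → Program n (Vec ℕ k)
  submitAll {zero}  xs = return []
  submitAll {suc k} xs = query (xs zero) λ b → submitAll (xs ∘ suc) >>= λ bs → return (b ∷ bs)

  run-submitAll : ∀ {k} (xs : Fin k → Code n) y → run (submitAll xs) y ≡ Vec.tabulate (λ i → black (xs i) y)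
  run-submitAll {zero}  xs y = refl
  run-submitAll {suc k} xs y =
    trans (run->>= (submitAll (xs ∘ suc)) _ y) (cong (black (xs zero) y ∷_) (run-submitAll (xs ∘ suc) y))

  cost-submitAll : ∀ {k} (xs : Fin k → Code n) y → cost (submitAll xs) y ≡ k
  cost-submitAll {zero}  xs y = refl
  cost-submitAll {suc k} xs y =
    cong suc (trans (cost->>= (submitAll (xs ∘ suc)) _ y) (trans (+-identityʳ _) (cost-submitAll (xs ∘ suc) y)))

  acceptOr : Program n (Code n) → Code n → Program n (Code n)
  acceptOr q z = submit z >>= λ b → if? b ≟ℕ n then return z else q

  infixl 0 _orElse_
  _orElse_ : Program n (Code n) → Program n (Code n) → Program n (Code n)
  p orElse q = p >>= acceptOr q

  orElse-correct : ∀ p q y → run p y ≗ᶜ y ⊎ run q y ≗ᶜ y → run (p orElse q) y ≗ᶜ y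
  orElse-correct p q y ok rewrite run->>= p (acceptOr q) y
    with black (run p y) y ≟ℕ n | ok
  ... | yes b≡n | _         = black≡n⇒≗ (run p y) y b≡n
  ... | no  b≢n | inj₁ p-ok = ⊥-elim (b≢n (≗⇒black≡n (run p y) y p-ok))
  ... | no  _   | inj₂ q-ok = q-ok

  orElse-cost : ∀ p q y → cost (p orElse q) y ≤ cost p y + suc (cost q y)
  orElse-cost p q y rewrite cost->>= p (acceptOr q) y
    with black (run p y) y ≟ℕ n
  ... | yes _ = +-monoʳ-≤ (cost p y) (s≤s z≤n)
  ... | no  _ = ≤-refl

-- Binary search

midpoint : ℕ → ℕ → ℕ
midpoint lo hi = lo + ⌊ hi ∸ lo /2⌋

midpoint-< : ∀ {lo hi} → lo < hi → midpoint lo hi < hi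
midpoint-< {lo} {hi} lo<hi = begin-strict
  lo + ⌊ hi ∸ lo /2⌋  <⟨ +-monoʳ-< lo (half< (m<n⇒0<n∸m lo<hi)) ⟩
  lo + (hi ∸ lo)      ≡⟨ m+[n∸m]≡n (<⇒≤ lo<hi) ⟩
  hi                  ∎
  where
  open ≤-Reasoning
  half< : ∀ {d} → 0 < d → ⌊ d /2⌋ < d
  half< {suc d} _ = ⌊n/2⌋<n d

midpoint∸lo : ∀ lo hi → midpoint lo hi ∸ lo ≤ ⌈ hi ∸ lo /2⌉
midpoint∸lo lo hi = subst (_≤ ⌈ hi ∸ lo /2⌉) (sym (m+n∸m≡n lo _)) (⌊n/2⌋≤⌈n/2⌉ (hi ∸ lo))

hi∸midpoint : ∀ lo hi → hi ∸ midpoint lo hi ≡ ⌈ hi ∸ lo /2⌉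
hi∸midpoint lo hi = begin
  hi ∸ (lo + ⌊ d /2⌋)              ≡⟨ ∸-+-assoc hi lo _ ⟨
  d ∸ ⌊ d /2⌋                      ≡⟨ cong (_∸ ⌊ d /2⌋) (⌊n/2⌋+⌈n/2⌉≡n d) ⟨
  ⌊ d /2⌋ + ⌈ d /2⌉ ∸ ⌊ d /2⌋      ≡⟨ m+n∸m≡n ⌊ d /2⌋ _ ⟩
  ⌈ d /2⌉                          ∎
  where
  open ≡-Reasoning
  d = hi ∸ lo

⌈log₂⌉-half : ∀ {d d′ k} → ⌈log₂ d ⌉ ≤ suc k → d′ ≤ ⌈ d /2⌉ → ⌈log₂ d′ ⌉ ≤ k
⌈log₂⌉-half {d} lg d′≤ =
  ≤-trans (⌈log₂⌉-mono-≤ d′≤) (≤-trans (≤-reflexive (⌈log₂⌈n/2⌉⌉≡⌈log₂n⌉∸1 d)) (∸-monoˡ-≤ 1 lg))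

⌈log₂⌉≤0⇒≤1 : ∀ {d} → ⌈log₂ d ⌉ ≤ 0 → d ≤ 1
⌈log₂⌉≤0⇒≤1 {d} lg with 2 ≤? d
... | yes 2≤d = ⊥-elim (<⇒≱ (⌈log₂⌉-mono-≤ 2≤d) lg)
... | no  2≰d = ≤-pred (≰⇒> 2≰d)

Rise : (ℕ → ℕ) → ℕ → Set
Rise v l = v l ≡ 0 × 0 < v (suc l)

module _ {n : ℕ} where

  bisect : (ℕ → Program n ℕ) → ℕ → ℕ → ℕ → Program n ℕ
  narrow : (ℕ → Program n ℕ) → ℕ → ℕ → ℕ → ℕ → Program n ℕ

  bisect probe zero    lo hi = return lo
  bisect probe (suc k) lo hi = probe (midpoint lo hi) >>= narrow probe k lo hi

  narrow probe k lo hi u = if u ≡ᵇ 0 then bisect probe k (midpoint lo hi) hi else bisect probe k lo (midpoint lo hi)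

  module _ (probe : ℕ → Program n ℕ) (y : Code n) where

    bisect-rise : ∀ k {lo hi} → lo < hi → ⌈log₂ (hi ∸ lo) ⌉ ≤ k → run (probe lo) y ≡ 0 → 0 < run (probe hi) y →
                  run (bisect probe k lo hi) y < hi × Rise (λ l → run (probe l) y) (run (bisect probe k lo hi) y)
    bisect-rise zero {lo} {hi} lo<hi lg v-lo v-hi = lo<hi , v-lo , subst (λ h → 0 < run (probe h) y) hi≡1+lo v-hi
      where
      hi≡1+lo : hi ≡ suc lo
      hi≡1+lo = ≤-antisym (subst (hi ≤_) (+-comm lo 1) (subst (_≤ lo + 1) (m+[n∸m]≡n (<⇒≤ lo<hi))
                                                              (+-monoʳ-≤ lo (⌈log₂⌉≤0⇒≤1 lg)))) lo<hi
    bisect-rise (suc k) {lo} {hi} lo<hi lg v-lo v-hi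
      rewrite run->>= (probe (midpoint lo hi)) (narrow probe k lo hi) y
      with run (probe (midpoint lo hi)) y in v-mid
    ... | zero  = bisect-rise k (midpoint-< lo<hi) (⌈log₂⌉-half lg (≤-reflexive (hi∸midpoint lo hi))) v-mid v-hi
    ... | suc _ = let l<mid , rise = bisect-rise k lo<mid (⌈log₂⌉-half lg (midpoint∸lo lo hi)) v-lo
                                                 (subst (0 <_) (sym v-mid) z<s)
                  in <-trans l<mid (midpoint-< lo<hi) , rise
      where
      lo<mid : lo < midpoint lo hi
      lo<mid = ≤∧≢⇒< (m≤m+n lo _) λ lo≡mid →
                 0≢1+n (trans (sym v-lo) (trans (cong (λ l → run (probe l) y) lo≡mid) v-mid))

    bisect-cost : ∀ {c} → (∀ l → cost (probe l) y ≤ c) → ∀ k lo hi → cost (bisect probe k lo hi) y ≤ k * c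
    bisect-cost probe≤c zero    lo hi = z≤n
    bisect-cost {c} probe≤c (suc k) lo hi
      rewrite cost->>= (probe (midpoint lo hi)) (narrow probe k lo hi) y
      with run (probe (midpoint lo hi)) y
    ... | zero  = +-mono-≤ (probe≤c _) (bisect-cost probe≤c k _ hi)
    ... | suc _ = +-mono-≤ (probe≤c _) (bisect-cost probe≤c k lo _)

module _ {n} (i j : Fin n) where

  transpose-matchˡ : transpose i j ⟨$⟩ʳ i ≡ j
  transpose-matchˡ with i ≟ i
  ... | yes _   = refl
  ... | no  i≢i = ⊥-elim (i≢i refl)

  transpose-matchʳ : transpose i j ⟨$⟩ʳ j ≡ i
  transpose-matchʳ with j ≟ i
  ... | yes j≡i = j≡i
  ... | no  _ with j ≟ j
  ...   | yes _   = refl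
  ...   | no  j≢j = ⊥-elim (j≢j refl)

  transpose-other : ∀ {k} → k ≢ i → k ≢ j → transpose i j ⟨$⟩ʳ k ≡ k
  transpose-other {k} k≢i k≢j with k ≟ i
  ... | yes k≡i = ⊥-elim (k≢i k≡i)
  ... | no  _ with k ≟ j
  ...   | yes k≡j = ⊥-elim (k≢j k≡j)
  ...   | no  _   = refl

module Cyclic (m : ℕ) where

  N : ℕ
  N = suc m

  [_] : ℕ → Fin N
  [ k ] = k mod N

  infixl 6 _⊕_
  _⊕_ : Fin N → ℕ → Fin N
  q ⊕ a = [ toℕ q + a ]

  -- a + m * a = N * a, so `neg a` is an additive inverse of a modulo N.
  neg : ℕ → ℕ
  neg a = m * a

  []-cong : ∀ j k → j % N ≡ k % N → [ j ] ≡ [ k ]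
  []-cong j k eq = toℕ-injective (trans (toℕ-fromℕ< (m%n<n j N)) (trans eq (sym (toℕ-fromℕ< (m%n<n k N)))))

  []-toℕ : ∀ q → [ toℕ q ] ≡ q
  []-toℕ q = toℕ-injective (trans (toℕ-fromℕ< (m%n<n (toℕ q) N)) (m<n⇒m%n≡m (toℕ<n q)))

  []-injective : ∀ {i j} → i < N → j < N → [ i ] ≡ [ j ] → i ≡ j
  []-injective {i} {j} i<N j<N eq = begin
    i                ≡⟨ m<n⇒m%n≡m i<N ⟨
    i % N            ≡⟨ toℕ-fromℕ< (m%n<n i N) ⟨
    toℕ [ i ]        ≡⟨ cong toℕ eq ⟩
    toℕ [ j ]        ≡⟨ toℕ-fromℕ< (m%n<n j N) ⟩
    j % N            ≡⟨ m<n⇒m%n≡m j<N ⟩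
    j                ∎
    where open ≡-Reasoning

  []-⊕ : ∀ j k → [ j ] ⊕ k ≡ [ j + k ]
  []-⊕ j k = []-cong (toℕ [ j ] + k) (j + k) (begin
    (toℕ [ j ] + k) % N          ≡⟨ cong (λ t → (t + k) % N) (toℕ-fromℕ< (m%n<n j N)) ⟩
    (j % N + k) % N              ≡⟨ %-distribˡ-+ (j % N) k N ⟩
    (j % N % N + k % N) % N      ≡⟨ cong (λ t → (t + k % N) % N) (m%n%n≡m%n j N) ⟩
    (j % N + k % N) % N          ≡⟨ %-distribˡ-+ j k N ⟨
    (j + k) % N                  ∎)
    where open ≡-Reasoning

  ⊕-assoc : ∀ q a b → q ⊕ a ⊕ b ≡ q ⊕ (a + b)
  ⊕-assoc q a b = trans ([]-⊕ (toℕ q + a) b) (cong [_] (+-assoc (toℕ q) a b))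

  ⊕-identityʳ : ∀ q → q ⊕ 0 ≡ q
  ⊕-identityʳ q = trans (cong [_] (+-identityʳ (toℕ q))) ([]-toℕ q)

  ⊕-multiple : ∀ q j → q ⊕ j * N ≡ q
  ⊕-multiple q j = trans ([]-cong (toℕ q + j * N) (toℕ q) ([m+kn]%n≡m%n (toℕ q) j N)) ([]-toℕ q)

  ⊕-comm : ∀ q r → q ⊕ toℕ r ≡ r ⊕ toℕ q
  ⊕-comm q r = cong [_] (+-comm (toℕ q) (toℕ r))

  ⊕-toℕ : ∀ q r k → q ⊕ toℕ (r ⊕ k) ≡ q ⊕ (toℕ r + k)
  ⊕-toℕ q r k = trans (⊕-comm q (r ⊕ k)) (trans ([]-⊕ (toℕ r + k) (toℕ q)) (cong [_] (+-comm (toℕ r + k) (toℕ q))))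

  ⊕-neg : ∀ q a → q ⊕ a ⊕ neg a ≡ q
  ⊕-neg q a = trans (⊕-assoc q a (m * a)) (trans (cong (q ⊕_) (*-comm N a)) (⊕-multiple q a))

  ⊕-neg′ : ∀ q a → q ⊕ neg a ⊕ a ≡ q
  ⊕-neg′ q a = trans (⊕-assoc q (m * a) a) (trans (cong (q ⊕_) (trans (+-comm (m * a) a) (*-comm N a))) (⊕-multiple q a))

  ⊕-cancelʳ : ∀ {q r} a → q ⊕ a ≡ r ⊕ a → q ≡ r
  ⊕-cancelʳ {q} {r} a eq = trans (sym (⊕-neg q a)) (trans (cong (_⊕ neg a) eq) (⊕-neg r a))

  ⊕-cancelˡ : ∀ q {i j} → i < N → j < N → q ⊕ i ≡ q ⊕ j → i ≡ j
  ⊕-cancelˡ q {i} {j} i<N j<N eq = []-injective i<N j<N (⊕-cancelʳ (toℕ q) (begin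
    [ i ] ⊕ toℕ q   ≡⟨ []-⊕ i (toℕ q) ⟩
    [ i + toℕ q ]   ≡⟨ cong [_] (+-comm i (toℕ q)) ⟩
    q ⊕ i           ≡⟨ eq ⟩
    q ⊕ j           ≡⟨ cong [_] (+-comm (toℕ q) j) ⟩
    [ j + toℕ q ]   ≡⟨ []-⊕ j (toℕ q) ⟨
    [ j ] ⊕ toℕ q   ∎))
    where open ≡-Reasoning

  ⊕-period : ∀ q k → q ⊕ (k + N) ≡ q ⊕ k
  ⊕-period q k = []-cong (toℕ q + (k + N)) (toℕ q + k)
                   (trans (cong (_% N) (sym (+-assoc (toℕ q) k N))) ([m+n]%n≡m%n (toℕ q + k) N))

  ⊕-surjective : ∀ q r → ∃ λ t → r ≡ q ⊕ toℕ t
  ⊕-surjective q r = r ⊕ neg (toℕ q) , trans (sym (⊕-neg′ r (toℕ q))) (⊕-comm (r ⊕ neg (toℕ q)) q)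

  -- t ⊕ m is the predecessor of t, so a zero of s spreads around the whole cycle.
  zero-propagates : (s : Fin N → ℕ) → (∀ t → s (t ⊕ m) ≡ 0 → s t ≡ 0) → ∀ {t} → s t ≡ 0 → ∀ r → s r ≡ 0
  zero-propagates s step {t} sₜ≡0 r with ⊕-surjective t r
  ... | i , refl = go (toℕ i)
    where
    go : ∀ k → s (t ⊕ k) ≡ 0
    go zero    = trans (cong s (⊕-identityʳ t)) sₜ≡0
    go (suc k) = step (t ⊕ suc k) (trans (cong s (begin
      t ⊕ suc k ⊕ m    ≡⟨ ⊕-assoc t (suc k) m ⟩
      t ⊕ (suc k + m)  ≡⟨ cong (t ⊕_) (sym (+-suc k m)) ⟩
      t ⊕ (k + N)      ≡⟨ ⊕-period t k ⟩
      t ⊕ k            ∎)) (go k))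
      where open ≡-Reasoning

  shift : ℕ → Code N
  shift c = permutation (_⊕ c) (_⊕ neg c) (λ q → ⊕-neg′ q c) (λ q → ⊕-neg q c)

module Classes (m : ℕ) where
  open Cyclic m

  class-member : ∀ y c → 0 < black (shift c) y → ∃ λ q → q ⊕ c ≡ y ⟨$⟩ʳ q
  class-member y c inhabited = count>0⇒ (agreeAt? (shift c) y) (subst (0 <_) (black≡count (shift c) y) inhabited)

  class-empty : ∀ y c → black (shift c) y ≡ 0 → ∀ q → q ⊕ c ≢ y ⟨$⟩ʳ q
  class-empty y c empty = count≡0⇒ (agreeAt? (shift c) y) (trans (sym (black≡count (shift c) y)) empty)

  AllClassesInhabited : Code N → Set
  AllClassesInhabited y = ∀ (t : Fin N) → 0 < black (shift (toℕ t)) y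

  ∑-classSize : ∀ y → ∑[ t < N ] black (shift (toℕ t)) y ≡ N
  ∑-classSize y = begin
    ∑[ t < N ] black (shift (toℕ t)) y                      ≡⟨ sum-cong-≗ {N} (λ t → black≡count (shift (toℕ t)) y) ⟩
    ∑[ t < N ] ∑[ q < N ] indicator (q ⊕ toℕ t ≟ y ⟨$⟩ʳ q)  ≡⟨ ∑-comm {N} {N} (λ t q → indicator (q ⊕ toℕ t ≟ y ⟨$⟩ʳ q)) ⟩
    ∑[ q < N ] ∑[ t < N ] indicator (q ⊕ toℕ t ≟ y ⟨$⟩ʳ q)  ≡⟨ sum-cong-≗ (λ q → oneClass q (y ⟨$⟩ʳ q)) ⟩
    ∑[ q < N ] 1                                             ≡⟨ ∑-const-1 N ⟩
    N                                                        ∎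
    where
    open ≡-Reasoning
    oneClass : ∀ q v → ∑[ t < N ] indicator (q ⊕ toℕ t ≟ v) ≡ 1
    oneClass q v = begin
      ∑[ t < N ] indicator (q ⊕ toℕ t ≟ v)                ≡⟨ sum-cong-≗ (λ t → indicator-cong (q ⊕ toℕ t ≟ v) (t ⊕ toℕ q ≟ v)
                                                               (trans (⊕-comm t q)) (trans (⊕-comm q t))) ⟩
      ∑[ t < N ] indicator (shift (toℕ q) ⟨$⟩ʳ t ≟ v)     ≡⟨ ∑-permute (λ w → indicator (w ≟ v)) (shift (toℕ q)) ⟨
      count (_≟ v)                                        ≡⟨ count-singleton v ⟩
      1                                                   ∎

  inhabited-without-rise : ∀ y → (∀ t → black (shift (toℕ (t ⊕ m))) y ≡ 0 → black (shift (toℕ t)) y ≡ 0) →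
                           AllClassesInhabited y
  inhabited-without-rise y no-rise t = n≢0⇒n>0 λ empty → 0≢1+n (begin
    0                                   ≡⟨ sum-replicate-zero N ⟨
    ∑[ r < N ] 0                        ≡⟨ sum-cong-≗ {N} (sym ∘ zero-propagates (λ r → black (shift (toℕ r)) y) no-rise {t} empty) ⟩
    ∑[ r < N ] black (shift (toℕ r)) y  ≡⟨ ∑-classSize y ⟩
    N                                   ∎)
    where open ≡-Reasoning

  transpose-uninhabits : ∀ {u v} → u ≢ v → ∀ y → AllClassesInhabited y →
                         ¬ AllClassesInhabited (y ∘ₚ flip (transpose u v))
  transpose-uninhabits {u} {v} u≢v y inhabited-y inhabited-π = <⇒≱ two-in-class (≤-reflexive one-in-class)
    where
    π = y ∘ₚ flip (transpose u v)
    a = y ⟨$⟩ˡ u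
    t = proj₁ (⊕-surjective a v)
    a⊕t≡v : a ⊕ toℕ t ≡ v
    a⊕t≡v = sym (proj₂ (⊕-surjective a v))
    q = proj₁ (class-member y (toℕ t) (inhabited-y t))
    q⊕t≡yq : q ⊕ toℕ t ≡ y ⟨$⟩ʳ q
    q⊕t≡yq = proj₂ (class-member y (toℕ t) (inhabited-y t))
    yq≢u : y ⟨$⟩ʳ q ≢ u
    yq≢u yq≡u = u≢v (trans (sym yq≡u) (trans (sym q⊕t≡yq)
                     (trans (cong (_⊕ toℕ t) (trans (sym (inverseˡ y)) (cong (y ⟨$⟩ˡ_) yq≡u))) a⊕t≡v)))
    yq≢v : y ⟨$⟩ʳ q ≢ v
    yq≢v yq≡v = yq≢u (trans (cong (y ⟨$⟩ʳ_) (⊕-cancelʳ (toℕ t) (trans q⊕t≡yq (trans yq≡v (sym a⊕t≡v)))))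
                            (inverseʳ y))
    a≢q : a ≢ q
    a≢q a≡q = yq≢u (trans (cong (y ⟨$⟩ʳ_) (sym a≡q)) (inverseʳ y))
    two-in-class : 2 ≤ black (shift (toℕ t)) π
    two-in-class = subst (2 ≤_) (sym (black≡count (shift (toℕ t)) π)) (count≥2 (agreeAt? (shift (toℕ t)) π) a≢q
      (trans a⊕t≡v (sym (trans (cong (transpose v u ⟨$⟩ʳ_) (inverseʳ y)) (transpose-matchʳ v u))))
      (trans q⊕t≡yq (sym (transpose-other v u yq≢v yq≢u))))
    one-in-class : black (shift (toℕ t)) π ≡ 1
    one-in-class = sym (∑-≤-≡ inhabited-π (trans (∑-const-1 N) (sym (∑-classSize π))) t)

-- Knowledge of the secret

module _ {n : ℕ} where

  preimage : (Fin n → Fin n) → Fin n → Fin n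
  preimage f v with any? (λ q → f q ≟ v)
  ... | yes (q , _) = q
  ... | no  _       = v

  preimage-spec : ∀ (f : Fin n → Fin n) {v} → (∃ λ q → f q ≡ v) → f (preimage f v) ≡ v
  preimage-spec f {v} hit with any? (λ q → f q ≟ v)
  ... | yes (_ , fq≡v) = fq≡v
  ... | no  none       = ⊥-elim (none hit)

  -- The permutation f, if it is one (its inverse found by search), and the identity otherwise.
  toCode : (Fin n → Fin n) → Code n
  toCode f = build (all? (λ v → f (preimage f v) ≟ v)) (all? (λ q → preimage f (f q) ≟ q))
    where
    build : Dec (∀ v → f (preimage f v) ≡ v) → Dec (∀ q → preimage f (f q) ≡ q) → Code n
    build (yes inverseˡ) (yes inverseʳ) = permutation f (preimage f) inverseˡ inverseʳ
    build _              _              = Perm.id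

  toCode-correct : ∀ (f : Fin n → Fin n) (y : Code n) → (∀ q → f q ≡ y ⟨$⟩ʳ q) → toCode f ≗ᶜ y
  toCode-correct f y f≗y
    with all? (λ v → f (preimage f v) ≟ v) | all? (λ q → preimage f (f q) ≟ q)
  ... | yes _    | yes _    = f≗y
  ... | no ¬invˡ | _        = ⊥-elim (¬invˡ inverseˡ′)
    where
    inverseˡ′ : ∀ v → f (preimage f v) ≡ v
    inverseˡ′ v = preimage-spec f {v} (y ⟨$⟩ˡ v , trans (f≗y (y ⟨$⟩ˡ v)) (inverseʳ y))
  ... | yes invˡ | no ¬invʳ =
    ⊥-elim (¬invʳ λ q → ⟨$⟩ʳ-injective y (trans (sym (f≗y (preimage f (f q)))) (trans (invˡ (f q)) (f≗y q))))

-- What the codebreaker has learnt: κ q = just w records that y q = w; κ q = nothing marks q as free.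
Knowledge : ℕ → Set
Knowledge n = Fin n → Maybe (Fin n)

module _ {n : ℕ} (κ : Knowledge n) where

  Free : Fin n → Set
  Free q = κ q ≡ nothing

  free? : Decidable Free
  free? q = Maybe.≡-dec _≟_ (κ q) nothing

  Consistent : Code n → Set
  Consistent y = ∀ q {w} → κ q ≡ just w → y ⟨$⟩ʳ q ≡ w

  FreeWith : Code n → Fin n → Fin n → Set
  FreeWith y p v = Free p × v ≡ y ⟨$⟩ʳ p

  knownMatch? : (x : Code n) → Decidable (λ q → κ q ≡ just (x ⟨$⟩ʳ q))
  knownMatch? x q = Maybe.≡-dec _≟_ (κ q) (just (x ⟨$⟩ʳ q))

  freeMatch? : (x y : Code n) → Decidable (λ q → FreeWith y q (x ⟨$⟩ʳ q))
  freeMatch? x y q = free? q ×-dec agreeAt? x y q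

  knownHits : Code n → ℕ
  knownHits x = count (knownMatch? x)

  freeHits : Code n → Code n → ℕ
  freeHits x y = count (freeMatch? x y)

  black-split : ∀ x y → Consistent y → black x y ≡ knownHits x + freeHits x y
  black-split x y consistent =
    trans (black≡count x y) (trans (sum-cong-≗ split)
                                   (∑-distrib-+ (λ q → indicator (knownMatch? x q)) (λ q → indicator (freeMatch? x y q))))
    where
    split : ∀ q → indicator (agreeAt? x y q) ≡ indicator (knownMatch? x q) + indicator (freeMatch? x y q)
    split q = by-cases (κ q) refl
      where
      by-cases : ∀ k → κ q ≡ k → indicator (agreeAt? x y q) ≡ indicator (knownMatch? x q) + indicator (freeMatch? x y q)
      by-cases nothing κq = cong₂ _+_
        (sym (indicator-no (knownMatch? x q) (λ κq≡just → case trans (sym κq) κq≡just of λ ())))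
        (indicator-cong (agreeAt? x y q) (freeMatch? x y q) (κq ,_) proj₂)
      by-cases (just w) κq = trans
        (indicator-cong (agreeAt? x y q) (knownMatch? x q)
          (λ xq≡yq → trans κq (cong just (trans (sym (consistent q κq)) (sym xq≡yq))))
          (λ κq≡just → trans (Maybe.just-injective (trans (sym κq≡just) κq)) (sym (consistent q κq))))
        (sym (trans (cong (indicator (knownMatch? x q) +_)
                          (indicator-no (freeMatch? x y q) (λ (free , _) → case trans (sym κq) free of λ ())))
                    (+-identityʳ _)))

  black∸knownHits : ∀ x y → Consistent y → black x y ∸ knownHits x ≡ freeHits x y
  black∸knownHits x y consistent =
    trans (cong (_∸ knownHits x) (black-split x y consistent)) (m+n∸m≡n (knownHits x) (freeHits x y))

module _ {n : ℕ} where

  freeCount : Knowledge n → ℕ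
  freeCount κ = count (free? κ)

  learn : Knowledge n → Fin n → Fin n → Knowledge n
  learn κ p w = updateAt κ p (λ _ → just w)

  module _ (κ : Knowledge n) (p w : Fin n) where

    learn-consistent : ∀ {y} → Consistent κ y → y ⟨$⟩ʳ p ≡ w → Consistent (learn κ p w) y
    learn-consistent consistent yp≡w q κ′q≡just with q ≟ p
    ... | yes refl = trans yp≡w (Maybe.just-injective (trans (sym (updateAt-updates p κ)) κ′q≡just))
    ... | no  q≢p  = consistent q (trans (sym (updateAt-minimal q p κ q≢p)) κ′q≡just)

    learnt : ¬ Free (learn κ p w) p
    learnt free′ = case trans (sym (updateAt-updates p κ)) free′ of λ ()

    learn-free : ∀ {q} → Free (learn κ p w) q → Free κ q
    learn-free {q} free′ with q ≟ p
    ... | yes refl = ⊥-elim (learnt free′)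
    ... | no  q≢p  = trans (sym (updateAt-minimal q p κ q≢p)) free′

    learn-freeCount : Free κ p → suc (freeCount (learn κ p w)) ≡ freeCount κ
    learn-freeCount free = begin
      suc (freeCount κ′)                      ≡⟨ +-comm 1 _ ⟩
      freeCount κ′ + 1                        ≡⟨ cong (freeCount κ′ +_) (indicator-yes (free? κ p) free) ⟨
      freeCount κ′ + indicator (free? κ p)    ≡⟨ ∑-update _ _ p unchanged ⟩
      freeCount κ + indicator (free? κ′ p)    ≡⟨ cong (freeCount κ +_) (indicator-no (free? κ′ p) learnt) ⟩
      freeCount κ + 0                         ≡⟨ +-identityʳ _ ⟩
      freeCount κ                             ∎
      where
      open ≡-Reasoning
      κ′ = learn κ p w
      unchanged : ∀ q → q ≢ p → indicator (free? κ′ q) ≡ indicator (free? κ q)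
      unchanged q q≢p = indicator-cong (free? κ′ q) (free? κ q)
                          (trans (sym (updateAt-minimal q p κ q≢p))) (trans (updateAt-minimal q p κ q≢p))

  decode : Knowledge n → Code n
  decode κ = toCode (λ q → fromMaybe q (κ q))

  decode-correct : ∀ κ y → Consistent κ y → (∀ q → ¬ Free κ q) → decode κ ≗ᶜ y
  decode-correct κ y consistent complete = toCode-correct _ y value
    where
    value : ∀ q → fromMaybe q (κ q) ≡ y ⟨$⟩ʳ q
    value q with κ q in κq
    ... | just w  = sym (consistent q κq)
    ... | nothing = ⊥-elim (complete q κq)

module Rotations (m : ℕ) where
  open Cyclic m

  -- shift (c - 1) with the value a + (c - 1) carried along positions a, a + 1, ..., a + l;
  -- positions a + i with i < l are then shifted by c.
  rotation : Fin N → ℕ → ℕ → Code N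
  rotation a c zero    = shift (c + m)
  rotation a c (suc l) = transpose (a ⊕ l) (a ⊕ suc l) ∘ₚ rotation a c l

  ⊕-distinct : ∀ a {i j} → i < N → j < N → i ≢ j → a ⊕ i ≢ a ⊕ j
  ⊕-distinct a i<N j<N i≢j = i≢j ∘ ⊕-cancelˡ a i<N j<N

  rotation-values : ∀ a c {l} → l < N →
                    rotation a c l ⟨$⟩ʳ (a ⊕ l) ≡ a ⊕ (c + m) ×
                    (∀ {j} → l < j → j < N → rotation a c l ⟨$⟩ʳ (a ⊕ j) ≡ a ⊕ j ⊕ (c + m))
  rotation-values a c {zero}  _     = cong (_⊕ (c + m)) (⊕-identityʳ a) , λ _ _ → refl
  rotation-values a c {suc l} 1+l<N =
    trans (cong (rotation a c l ⟨$⟩ʳ_) (transpose-matchʳ (a ⊕ l) (a ⊕ suc l))) at-l ,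
    λ {j} 1+l<j j<N → trans (cong (rotation a c l ⟨$⟩ʳ_) (transpose-other (a ⊕ l) (a ⊕ suc l)
                              (⊕-distinct a j<N l<N (λ j≡l → <-irrefl (sym j≡l) (<-trans (n<1+n l) 1+l<j)))
                              (⊕-distinct a j<N 1+l<N (λ j≡1+l → <-irrefl (sym j≡1+l) 1+l<j))))
                          (beyond (<-trans (n<1+n l) 1+l<j) j<N)
    where
    l<N = <-trans (n<1+n l) 1+l<N
    at-l = proj₁ (rotation-values a c l<N)
    beyond = proj₂ (rotation-values a c l<N)

  module RotationHits (κ : Knowledge N) (y : Code N) (a : Fin N) (c : ℕ)
                      (exhausted : ∀ q → Free κ q → q ⊕ (c + m) ≢ y ⟨$⟩ʳ q) where

    hits : ℕ → ℕ
    hits l = freeHits κ (rotation a c l) y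

    inClass : ℕ → ℕ
    inClass i = indicator (freeMatch? κ (shift c) y (a ⊕ i))

    carries : ℕ → ℕ
    carries l = indicator (free? κ (a ⊕ l) ×-dec (a ⊕ (c + m) ≟ y ⟨$⟩ʳ (a ⊕ l)))

    matches-at : ∀ x q {v} → x ⟨$⟩ʳ q ≡ v →
                 indicator (freeMatch? κ x y q) ≡ indicator (free? κ q ×-dec (v ≟ y ⟨$⟩ʳ q))
    matches-at x q xq≡v = indicator-cong (freeMatch? κ x y q) (free? κ q ×-dec _)
                          (λ (free , eq) → free , trans (sym xq≡v) eq) (λ (free , eq) → free , trans xq≡v eq)

    earlier : ℕ → ℕ
    earlier zero    = 0
    earlier (suc l) = earlier l + inClass l

    hits-zero : hits 0 ≡ 0
    hits-zero = count-none (freeMatch? κ (rotation a c 0) y) (λ q (free , eq) → exhausted q free eq)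

    -- rotation a c (l + 1) differs from rotation a c l only at the positions a + l and a + (l + 1).
    hits-step : ∀ {l} → suc l < N → hits (suc l) + carries l ≡ hits l + (inClass l + carries (suc l))
    hits-step {l} 1+l<N = begin
      hits (suc l) + carries l               ≡⟨ cong (hits (suc l) +_) (+-identityʳ _) ⟨
      hits (suc l) + (carries l + 0)         ≡⟨ cong₂ (λ u v → hits (suc l) + (u + v)) g₁ g₂ ⟨
      hits (suc l) + (g p₁ + g p₂)           ≡⟨ ∑-update₂ f g p₁ p₂ p₁≢p₂ unchanged ⟩
      hits l + (f p₁ + f p₂)                 ≡⟨ cong₂ (λ u v → hits l + (u + v)) f₁ f₂ ⟩
      hits l + (inClass l + carries (suc l)) ∎
      where
      open ≡-Reasoning
      reassociate : ∀ l c m → suc l + (c + m) ≡ l + c + suc m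
      reassociate = solve-∀
      l<N = <-trans (n<1+n l) 1+l<N
      p₁ = a ⊕ l
      p₂ = a ⊕ suc l
      p₁≢p₂ = ⊕-distinct a l<N 1+l<N (<⇒≢ (n<1+n l))
      f g : Fin N → ℕ
      f q = indicator (freeMatch? κ (rotation a c (suc l)) y q)
      g q = indicator (freeMatch? κ (rotation a c l) y q)
      at-l = proj₁ (rotation-values a c l<N)
      beyond = proj₂ (rotation-values a c l<N)
      unchanged : ∀ q → q ≢ p₁ → q ≢ p₂ → f q ≡ g q
      unchanged q q≢p₁ q≢p₂ = trans (matches-at (rotation a c (suc l)) q
                                      (cong (rotation a c l ⟨$⟩ʳ_) (transpose-other p₁ p₂ q≢p₁ q≢p₂)))
                                    (sym (matches-at (rotation a c l) q refl))
      g₁ : g p₁ ≡ carries l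
      g₁ = matches-at (rotation a c l) p₁ at-l
      g₂ : g p₂ ≡ 0
      g₂ = indicator-no (freeMatch? κ (rotation a c l) y p₂)
             (λ (free , eq) → exhausted p₂ free (trans (sym (beyond (n<1+n l) 1+l<N)) eq))
      f₁ : f p₁ ≡ inClass l
      f₁ = matches-at (rotation a c (suc l)) p₁ (begin
        rotation a c l ⟨$⟩ʳ (transpose p₁ p₂ ⟨$⟩ʳ p₁)  ≡⟨ cong (rotation a c l ⟨$⟩ʳ_) (transpose-matchˡ p₁ p₂) ⟩
        rotation a c l ⟨$⟩ʳ p₂                        ≡⟨ beyond (n<1+n l) 1+l<N ⟩
        a ⊕ suc l ⊕ (c + m)                           ≡⟨ ⊕-assoc a (suc l) (c + m) ⟩
        a ⊕ (suc l + (c + m))                         ≡⟨ cong (a ⊕_) (reassociate l c m) ⟩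
        a ⊕ (l + c + N)                               ≡⟨ ⊕-period a (l + c) ⟩
        a ⊕ (l + c)                                   ≡⟨ ⊕-assoc a l c ⟨
        p₁ ⊕ c                                        ∎)
      f₂ : f p₂ ≡ carries (suc l)
      f₂ = matches-at (rotation a c (suc l)) p₂ (trans (cong (rotation a c l ⟨$⟩ʳ_) (transpose-matchʳ p₁ p₂)) at-l)

    hits-formula : ∀ {l} → l < N → hits l ≡ earlier l + carries l
    hits-formula {zero}  _     = trans hits-zero (sym (indicator-no (free? κ (a ⊕ 0) ×-dec _) λ (free , eq) →
                                   exhausted (a ⊕ 0) free (trans (cong (_⊕ (c + m)) (⊕-identityʳ a)) eq)))
    hits-formula {suc l} 1+l<N = +-cancelʳ-≡ (carries l) _ _ (begin
      hits (suc l) + carries l                              ≡⟨ hits-step 1+l<N ⟩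
      hits l + (inClass l + carries (suc l))                ≡⟨ cong (_+ (inClass l + carries (suc l)))
                                                                    (hits-formula (<-trans (n<1+n l) 1+l<N)) ⟩
      earlier l + carries l + (inClass l + carries (suc l)) ≡⟨ rearrange (earlier l) (carries l) (inClass l) (carries (suc l)) ⟩
      earlier (suc l) + carries (suc l) + carries l         ∎)
      where
      open ≡-Reasoning
      rearrange : ∀ e s i s′ → e + s + (i + s′) ≡ e + i + s′ + s
      rearrange = solve-∀

    earlier-≥ : ∀ {i l} → i < l → inClass i ≤ earlier l
    earlier-≥ {i} {suc l} i<1+l with m≤n⇒m<n∨m≡n (≤-pred i<1+l)
    ... | inj₁ i<l  = ≤-trans (earlier-≥ i<l) (m≤m+n _ _)
    ... | inj₂ refl = m≤n+m _ _

    hits-top : ∀ {q} → FreeWith κ y q (q ⊕ c) → 0 < hits m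
    hits-top {q} (free , q⊕c≡yq) with ⊕-surjective a q
    ... | i , refl = subst (0 <_) (sym (hits-formula ≤-refl)) (case m≤n⇒m<n∨m≡n (≤-pred (toℕ<n i)) of λ where
      (inj₁ i<m) → ≤-trans (≤-trans (≤-reflexive (sym (indicator-yes (freeMatch? κ (shift c) y _) (free , q⊕c≡yq))))
                                    (earlier-≥ i<m)) (m≤m+n _ _)
      (inj₂ i≡m) → ≤-trans (≤-reflexive (sym (indicator-yes (free? κ (a ⊕ m) ×-dec _) (last-carries i≡m)))) (m≤n+m _ _))
      where
      last-carries : toℕ i ≡ m → FreeWith κ y (a ⊕ m) (a ⊕ (c + m))
      last-carries i≡m with subst (λ k → FreeWith κ y (a ⊕ k) (a ⊕ k ⊕ c)) i≡m (free , q⊕c≡yq)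
      ... | free′ , a⊕m⊕c≡y = free′ , trans (trans (cong (a ⊕_) (+-comm c m)) (sym (⊕-assoc a m c))) a⊕m⊕c≡y

    hits-rise : ∀ {l} → suc l < N → Rise hits l →
                FreeWith κ y (a ⊕ l) (a ⊕ l ⊕ c) ⊎ FreeWith κ y (a ⊕ suc l) (a ⊕ (c + m))
    hits-rise {l} 1+l<N (hits≡0 , hits>0) =
      Sum.map₂ (indicator>0⇒ (free? κ (a ⊕ suc l) ×-dec _))
               (indicator+-positive (freeMatch? κ (shift c) y (a ⊕ l)) rest>0)
      where
      earlier≡0 : earlier l ≡ 0
      earlier≡0 = m+n≡0⇒m≡0 (earlier l) (trans (sym (hits-formula (<-trans (n<1+n l) 1+l<N))) hits≡0)
      rest>0 : 0 < inClass l + carries (suc l)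
      rest>0 = subst (λ e → 0 < e + inClass l + carries (suc l)) earlier≡0 (subst (0 <_) (hits-formula 1+l<N) hits>0)

module Search (m : ℕ) where
  open Cyclic m
  open Rotations m

  L : ℕ
  L = ⌈log₂ N ⌉

  probe : Knowledge N → Fin N → ℕ → ℕ → Program N ℕ
  probe κ a c l = submit (rotation a c l) >>= λ b → return (b ∸ knownHits κ (rotation a c l))

  locate : Knowledge N → Fin N → ℕ → Program N ℕ
  locate κ a c = bisect (probe κ a c) L 0 m

  locate-cost : ∀ κ a c y → cost (locate κ a c) y ≤ L
  locate-cost κ a c y =
    subst (cost (locate κ a c) y ≤_) (*-identityʳ L) (bisect-cost (probe κ a c) y (λ _ → ≤-refl) L 0 m)

  module _ (κ : Knowledge N) (y : Code N) (consistent : Consistent κ y) (a : Fin N) (c : ℕ)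
           (exhausted : ∀ q → Free κ q → q ⊕ (c + m) ≢ y ⟨$⟩ʳ q) where
    open RotationHits κ y a c exhausted

    run-probe : ∀ l → run (probe κ a c l) y ≡ hits l
    run-probe l = black∸knownHits κ (rotation a c l) y consistent

    locate-spec : ∀ {q} → FreeWith κ y q (q ⊕ c) →
                  let l = run (locate κ a c) y in
                  FreeWith κ y (a ⊕ l) (a ⊕ l ⊕ c) ⊎ FreeWith κ y (a ⊕ suc l) (a ⊕ (c + m))
    locate-spec member =
      hits-rise (s≤s l<m) (trans (sym (run-probe l)) probe-l≡0 , subst (0 <_) (run-probe (suc l)) probe-1+l>0)
      where
      top = hits-top member
      0<m : 0 < m
      0<m = n≢0⇒n>0 λ m≡0 → <⇒≢ top (sym (trans (cong hits m≡0) hits-zero))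
      l = run (locate κ a c) y
      found = bisect-rise (probe κ a c) y L 0<m (⌈log₂⌉-mono-≤ (n≤1+n m))
                          (trans (run-probe 0) hits-zero) (subst (0 <_) (sym (run-probe m)) top)
      l<m = proj₁ found
      probe-l≡0 = proj₁ (proj₂ found)
      probe-1+l>0 = proj₂ (proj₂ found)

module Completion (m : ℕ) where
  open Cyclic m
  open Search m

  anchor : Fin N → ℕ → Fin N
  anchor w c = w ⊕ neg (c + m)

  learnMember : Knowledge N → Fin N → ℕ → ℕ → Knowledge N
  learnMember κ a c l = learn κ (a ⊕ l) (a ⊕ l ⊕ c)

  -- Works through the classes c, c + 1, …, c + r - 1, learning their free members one binary
  -- search at a time; w is a value already known, used to anchor the searches.
  solve    : Fin N → ℕ → ℕ → ℕ → Knowledge N → Program N (Code N)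
  continue : Fin N → ℕ → ℕ → ℕ → Knowledge N → ℕ → Program N (Code N)

  solve w zero    r       c κ = return (decode κ)
  solve w (suc f) zero    c κ = return (decode κ)
  solve w (suc f) (suc r) c κ = submit (shift c) >>= λ b → continue w f r c κ (b ∸ knownHits κ (shift c))

  continue w f r c κ zero    = solve w f r (suc c) κ
  continue w f r c κ (suc _) = locate κ (anchor w c) c >>= solve w f (suc r) c ∘ learnMember κ (anchor w c) c

  solve-cost    : ∀ w f r c κ y → cost (solve w f r c κ) y ≤ f * suc L
  continue-cost : ∀ w f r c κ y u → cost (continue w f r c κ u) y ≤ L + f * suc L

  solve-cost w zero    r       c κ y = z≤n
  solve-cost w (suc f) zero    c κ y = z≤n
  solve-cost w (suc f) (suc r) c κ y = s≤s (continue-cost w f r c κ y (black (shift c) y ∸ knownHits κ (shift c)))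

  continue-cost w f r c κ y zero    = ≤-trans (solve-cost w f r (suc c) κ y) (m≤n+m _ L)
  continue-cost w f r c κ y (suc _) = begin
    cost (locate κ a c >>= k) y                              ≡⟨ cost->>= (locate κ a c) k y ⟩
    cost (locate κ a c) y + cost (k (run (locate κ a c) y)) y ≤⟨ +-mono-≤ (locate-cost κ a c y) (solve-cost w f (suc r) c _ y) ⟩
    L + f * suc L                                            ∎
    where
    open ≤-Reasoning
    a = anchor w c
    k = solve w f (suc r) c ∘ learnMember κ a c

  record Invariant (y : Code N) (w : Fin N) (f r c : ℕ) (κ : Knowledge N) : Set where
    field
      consistent : Consistent κ y
      window     : ∀ q → Free κ q → ∃ λ j → j < r × q ⊕ (c + j) ≡ y ⟨$⟩ʳ q
      r≤m        : r ≤ m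
      anchored   : ∀ q → Free κ q → w ≢ y ⟨$⟩ʳ q
      fuel       : r + freeCount κ < f

  module _ {y w f r c κ} (inv : Invariant y w (suc f) (suc r) c κ) where
    open Invariant inv

    next-class : freeHits κ (shift c) y ≡ 0 → Invariant y w f r (suc c) κ
    next-class none = record
      { consistent = consistent
      ; window     = window′
      ; r≤m        = ≤-trans (n≤1+n r) r≤m
      ; anchored   = anchored
      ; fuel       = ≤-pred fuel
      }
      where
      window′ : ∀ q → Free κ q → ∃ λ j → j < r × q ⊕ (suc c + j) ≡ y ⟨$⟩ʳ q
      window′ q free with window q free
      ... | zero  , _     , q⊕c+0≡yq = ⊥-elim (count≡0⇒ (freeMatch? κ (shift c) y) none q
                                         (free , trans (cong (q ⊕_) (sym (+-identityʳ c))) q⊕c+0≡yq))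
      ... | suc j , 1+j<1+r , q⊕c+1+j≡yq = j , ≤-pred 1+j<1+r , trans (cong (q ⊕_) (sym (+-suc c j))) q⊕c+1+j≡yq

    exhausted : ∀ q → Free κ q → q ⊕ (c + m) ≢ y ⟨$⟩ʳ q
    exhausted q free q⊕c+m≡yq with window q free
    ... | j , j<1+r , q⊕c+j≡yq = <-irrefl j≡m (≤-trans j<1+r r≤m)
      where
      j≡m : j ≡ m
      j≡m = ⊕-cancelˡ (q ⊕ c) (≤-trans j<1+r (≤-trans r≤m (n≤1+n m))) ≤-refl
              (trans (⊕-assoc q c j) (trans q⊕c+j≡yq (trans (sym q⊕c+m≡yq) (sym (⊕-assoc q c m)))))

    learn-member : ∀ {p} → Free κ p → p ⊕ c ≡ y ⟨$⟩ʳ p → Invariant y w f (suc r) c (learn κ p (p ⊕ c))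
    learn-member {p} free p⊕c≡yp = record
      { consistent = learn-consistent κ p (p ⊕ c) {y} consistent (sym p⊕c≡yp)
      ; window     = λ q → window q ∘ learn-free κ p (p ⊕ c)
      ; r≤m        = r≤m
      ; anchored   = λ q → anchored q ∘ learn-free κ p (p ⊕ c)
      ; fuel       = <-≤-trans (+-monoʳ-< (suc r) (subst (freeCount (learn κ p (p ⊕ c)) <_)
                                                            (learn-freeCount κ p (p ⊕ c) free) ≤-refl)) (≤-pred fuel)
      }

  solve-correct    : ∀ {y w f r c κ} → Invariant y w f r c κ → run (solve w f r c κ) y ≗ᶜ y
  continue-correct : ∀ {y w f r c κ} → Invariant y w (suc f) (suc r) c κ →
                     ∀ u → u ≡ freeHits κ (shift c) y → run (continue w f r c κ u) y ≗ᶜ y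

  solve-correct {f = zero}                 inv = ⊥-elim (n≮0 (Invariant.fuel inv))
  solve-correct {y} {f = suc f} {zero} {κ = κ} inv =
    decode-correct κ y consistent λ q free → let _ , j<0 , _ = window q free in n≮0 j<0
    where open Invariant inv
  solve-correct {y} {f = suc f} {suc r} {c} {κ} inv =
    continue-correct inv (black (shift c) y ∸ knownHits κ (shift c)) (black∸knownHits κ (shift c) y consistent)
    where open Invariant inv

  continue-correct inv zero    none = solve-correct (next-class inv (sym none))
  continue-correct {y} {w} {f} {r} {c} {κ} inv (suc _) some i =
    trans (cong (_⟨$⟩ʳ i) (run->>= (locate κ a c) (solve w f (suc r) c ∘ learnMember κ a c) y))
          (solve-correct (learn-member inv (proj₁ new-member) (proj₂ new-member)) i)
    where
    open Invariant inv
    a = anchor w c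
    l = run (locate κ a c) y
    member : ∃ λ q → FreeWith κ y q (q ⊕ c)
    member = count>0⇒ (freeMatch? κ (shift c) y) (subst (0 <_) some z<s)
    new-member : FreeWith κ y (a ⊕ l) (a ⊕ l ⊕ c)
    new-member = not-carried (locate-spec κ y consistent a c (exhausted inv) (proj₂ member))
      where
      not-carried : FreeWith κ y (a ⊕ l) (a ⊕ l ⊕ c) ⊎ FreeWith κ y (a ⊕ suc l) (a ⊕ (c + m)) →
                    FreeWith κ y (a ⊕ l) (a ⊕ l ⊕ c)
      not-carried (inj₁ found)             = found
      not-carried (inj₂ (free , a⊕c+m≡y)) = ⊥-elim (anchored (a ⊕ suc l) free (trans (sym (⊕-neg′ w (c + m))) a⊕c+m≡y))

module FromRise (m : ℕ) where
  open Cyclic m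
  open Search m
  open Completion m

  nothingKnown : Knowledge N
  nothingKnown _ = nothing

  initialFuel : ℕ
  initialFuel = N + N

  completeFrom : Fin N → Fin N → ℕ → Program N (Code N)
  completeFrom p w c = solve w initialFuel m c (learn nothingKnown p w)

  module _ (y : Code N) (c : ℕ) (exhausted : ∀ q → q ⊕ (c + m) ≢ y ⟨$⟩ʳ q) where

    completeFrom-correct : ∀ {p w} → y ⟨$⟩ʳ p ≡ w → run (completeFrom p w c) y ≗ᶜ y
    completeFrom-correct {p} {w} yp≡w = solve-correct record
      { consistent = learn-consistent nothingKnown p w {y} (λ _ ()) yp≡w
      ; window     = λ q _ → window q
      ; r≤m        = ≤-refl
      ; anchored   = λ q free w≡yq → learnt nothingKnown p w
                       (subst (Free (learn nothingKnown p w)) (⟨$⟩ʳ-injective y (trans (sym w≡yq) (sym yp≡w))) free)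
      ; fuel       = <-≤-trans (+-monoʳ-< m (s≤s (count≤n (free? (learn nothingKnown p w)))))
                               (≤-reflexive (+-suc m N))
      }
      where
      window : ∀ q → ∃ λ j → j < m × q ⊕ (c + j) ≡ y ⟨$⟩ʳ q
      window q with ⊕-surjective (q ⊕ c) (y ⟨$⟩ʳ q)
      ... | t , yq≡q⊕c⊕t = toℕ t , j<m , trans (sym (⊕-assoc q c (toℕ t))) (sym yq≡q⊕c⊕t)
        where
        j<m : toℕ t < m
        j<m = ≤∧≢⇒< (≤-pred (toℕ<n t)) λ t≡m → exhausted q (trans (cong (λ j → q ⊕ (c + j)) (sym t≡m))
                                                         (trans (sym (⊕-assoc q c (toℕ t))) (sym yq≡q⊕c⊕t)))

  -- The search cannot tell whether position l is in class t or position l + 1 holds t - 1,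
  -- so both readings are completed and the first one is verified with one extra query.
  candidates : ℕ → ℕ → Program N (Code N)
  candidates t l = completeFrom (zero ⊕ l) (zero ⊕ l ⊕ t) t orElse completeFrom (zero ⊕ suc l) (zero ⊕ (t + m)) t

  riseBudget : ℕ
  riseBudget = L + (initialFuel * suc L + suc (initialFuel * suc L))

  fromRise : ℕ → Program N (Code N)
  fromRise t = locate nothingKnown zero t >>= candidates t

  module _ (y : Code N) (t : ℕ) where
    private
      l = run (locate nothingKnown zero t) y
      readingˡ = completeFrom (zero ⊕ l) (zero ⊕ l ⊕ t) t
      readingʳ = completeFrom (zero ⊕ suc l) (zero ⊕ (t + m)) t

    fromRise-correct : (∀ q → q ⊕ (t + m) ≢ y ⟨$⟩ʳ q) → ∀ {q} → q ⊕ t ≡ y ⟨$⟩ʳ q → run (fromRise t) y ≗ᶜ y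
    fromRise-correct exhausted {q} q⊕t≡yq i =
      trans (cong (_⟨$⟩ʳ i) (run->>= (locate nothingKnown zero t) (candidates t) y))
            (orElse-correct readingˡ readingʳ y (Sum.map complete complete found) i)
      where
      complete : ∀ {p v} → FreeWith nothingKnown y p v → run (completeFrom p v t) y ≗ᶜ y
      complete = completeFrom-correct y t exhausted ∘ sym ∘ proj₂
      found = locate-spec nothingKnown y (λ _ ()) zero t (λ q _ → exhausted q) (refl , q⊕t≡yq)

    fromRise-cost : cost (fromRise t) y ≤ riseBudget
    fromRise-cost = begin
      cost (fromRise t) y                                           ≡⟨ cost->>= (locate nothingKnown zero t) (candidates t) y ⟩
      cost (locate nothingKnown zero t) y + cost (candidates t l) y ≤⟨ +-mono-≤ (locate-cost nothingKnown zero t y) candidates-cost ⟩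
      riseBudget                                                    ∎
      where
      open ≤-Reasoning
      candidates-cost : cost (candidates t l) y ≤ initialFuel * suc L + suc (initialFuel * suc L)
      candidates-cost = ≤-trans (orElse-cost readingˡ readingʳ y)
                                (+-mono-≤ (solve-cost _ initialFuel m t _ y) (s≤s (solve-cost _ initialFuel m t _ y)))

module Attempt (m : ℕ) where
  open Cyclic m
  open Classes m
  open FromRise m

  CyclicRise : (Fin N → ℕ) → Fin N → Set
  CyclicRise s t = s (t ⊕ m) ≡ 0 × 0 < s t

  cyclicRise? : ∀ s → Decidable (CyclicRise s)
  cyclicRise? s t = (s (t ⊕ m) ≟ℕ 0) ×-dec (0 <? s t)

  afterSizes : ∀ {s} → Dec (∃ (CyclicRise s)) → Program N (Maybe (Code N))
  afterSizes (yes (t , _)) = fromRise (toℕ t) >>= return ∘ just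
  afterSizes (no  _)       = return nothing

  examine : Vec ℕ N → Program N (Maybe (Code N))
  examine sizes = afterSizes (any? (cyclicRise? (Vec.lookup sizes)))

  shifts : Fin N → Code N
  shifts t = shift (toℕ t)

  attempt : Program N (Maybe (Code N))
  attempt = submitAll shifts >>= examine

  Sound : Code N → Maybe (Code N) → Set
  Sound y (just z) = z ≗ᶜ y
  Sound y nothing  = AllClassesInhabited y

  module _ (y : Code N) where

    afterSizes-sound : ∀ {s} → (∀ t → s t ≡ black (shift (toℕ t)) y) → (rise? : Dec (∃ (CyclicRise s))) →
                       Sound y (run (afterSizes rise?) y)
    afterSizes-sound {s} sizes (yes (t , before≡0 , positive)) =
      subst (Sound y) (sym (run->>= (fromRise (toℕ t)) (return ∘ just) y))
            (fromRise-correct y (toℕ t) exhausted (proj₂ member))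
      where
      exhausted : ∀ q → q ⊕ (toℕ t + m) ≢ y ⟨$⟩ʳ q
      exhausted q = class-empty y (toℕ (t ⊕ m)) (trans (sym (sizes (t ⊕ m))) before≡0) q ∘ trans (⊕-toℕ q t m)
      member : ∃ λ q → q ⊕ toℕ t ≡ y ⟨$⟩ʳ q
      member = class-member y (toℕ t) (subst (0 <_) (sizes t) positive)
    afterSizes-sound {s} sizes (no no-rise) = inhabited-without-rise y λ t before≡0 →
      trans (sym (sizes t)) (n≤0⇒n≡0 (≮⇒≥ λ positive →
        no-rise (t , trans (sizes (t ⊕ m)) before≡0 , positive)))

    attempt-sound : Sound y (run attempt y)
    attempt-sound = subst (Sound y) (sym (trans (run->>= (submitAll shifts) examine y)
                                               (cong (λ sizes → run (examine sizes) y) (run-submitAll shifts y))))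
                          (afterSizes-sound (lookup∘tabulate size) (any? (cyclicRise? (Vec.lookup (Vec.tabulate size)))))
      where
      size : Fin N → ℕ
      size t = black (shifts t) y

    afterSizes-cost : ∀ {s} (rise? : Dec (∃ (CyclicRise s))) → cost (afterSizes rise?) y ≤ riseBudget
    afterSizes-cost (yes (t , _)) = begin
      cost (fromRise (toℕ t) >>= return ∘ just) y ≡⟨ cost->>= (fromRise (toℕ t)) (return ∘ just) y ⟩
      cost (fromRise (toℕ t)) y + 0               ≡⟨ +-identityʳ _ ⟩
      cost (fromRise (toℕ t)) y                   ≤⟨ fromRise-cost y (toℕ t) ⟩
      riseBudget                                  ∎
      where open ≤-Reasoning
    afterSizes-cost (no _) = z≤n

    attempt-cost : cost attempt y ≤ N + riseBudget
    attempt-cost = begin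
      cost attempt y                                      ≡⟨ cost->>= (submitAll shifts) examine y ⟩
      cost (submitAll shifts) y + cost (examine sizes) y  ≤⟨ +-mono-≤ (≤-reflexive (cost-submitAll shifts y))
                                                                     (afterSizes-cost (any? (cyclicRise? (Vec.lookup sizes)))) ⟩
      N + riseBudget                                      ∎
      where
      open ≤-Reasoning
      sizes = run (submitAll shifts) y

budget-bound : ∀ n l → 1 ≤ n → 1 ≤ l →
               let b = n + (l + ((n + n) * suc l + suc ((n + n) * suc l))) in b + b ≤ 22 * (n * l)
budget-bound n l 1≤n 1≤l = begin
  b + b                                ≡⟨ expand n l ⟩
  8 * (n * l) + 10 * n + 2 * l + 2     ≤⟨ +-mono-≤ (+-mono-≤ (+-monoʳ-≤ (8 * (n * l)) (*-monoʳ-≤ 10 n≤nl)) (*-monoʳ-≤ 2 l≤nl))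
                                                   (*-monoʳ-≤ 2 (*-mono-≤ 1≤n 1≤l)) ⟩
  8 * (n * l) + 10 * (n * l) + 2 * (n * l) + 2 * (n * l) ≡⟨ collect (n * l) ⟩
  22 * (n * l)                         ∎
  where
  open ≤-Reasoning
  b = n + (l + ((n + n) * suc l + suc ((n + n) * suc l)))
  expand : ∀ n l → n + (l + ((n + n) * suc l + suc ((n + n) * suc l))) + (n + (l + ((n + n) * suc l + suc ((n + n) * suc l))))
                   ≡ 8 * (n * l) + 10 * n + 2 * l + 2
  expand = solve-∀
  collect : ∀ x → 8 * x + 10 * x + 2 * x + 2 * x ≡ 22 * x
  collect = solve-∀
  n≤nl : n ≤ n * l
  n≤nl = subst (_≤ n * l) (*-identityʳ n) (*-monoʳ-≤ n 1≤l)
  l≤nl : l ≤ n * l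
  l≤nl = subst (_≤ n * l) (*-identityˡ l) (*-monoˡ-≤ l 1≤n)

module Codebreaker (m′ : ℕ) where
  open Cyclic (suc m′)
  open Classes (suc m′)
  open Search (suc m′) using (L)
  open FromRise (suc m′) using (riseBudget)
  open Attempt (suc m′)

  τ : Code N
  τ = transpose zero (suc zero)

  -- The `nothing` case never arises, by transpose-uninhabits.
  undo : Maybe (Code N) → Code N
  undo = maybe′ (_∘ₚ τ) τ

  fallback : Maybe (Code N) → Program N (Code N)
  fallback (just z) = return z
  fallback nothing  = relabel τ attempt >>= return ∘ undo

  codebreaker : Program N (Code N)
  codebreaker = attempt >>= fallback

  budget : ℕ
  budget = N + riseBudget

  module _ (y : Code N) where

    undo-correct : ∀ r → AllClassesInhabited y → Sound (y ∘ₚ flip τ) r → undo r ≗ᶜ y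
    undo-correct (just z) _         z≗π i   = trans (cong (τ ⟨$⟩ʳ_) (z≗π i)) (inverseʳ τ)
    undo-correct nothing  inhabited inhabited-π = ⊥-elim (transpose-uninhabits (λ ()) y inhabited inhabited-π)

    fallback-correct : ∀ r → Sound y r → run (fallback r) y ≗ᶜ y
    fallback-correct (just z) z≗y       = z≗y
    fallback-correct nothing  inhabited =
      subst (_≗ᶜ y) (sym (trans (run->>= (relabel τ attempt) (return ∘ undo) y)
                                (cong undo (run-relabel τ attempt y))))
            (undo-correct (run attempt (y ∘ₚ flip τ)) inhabited (attempt-sound (y ∘ₚ flip τ)))

    codebreaker-correct : run codebreaker y ≗ᶜ y
    codebreaker-correct =
      subst (_≗ᶜ y) (sym (run->>= attempt fallback y)) (fallback-correct (run attempt y) (attempt-sound y))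

    fallback-cost : ∀ r → cost (fallback r) y ≤ budget
    fallback-cost (just z) = z≤n
    fallback-cost nothing  = begin
      cost (relabel τ attempt >>= return ∘ undo) y ≡⟨ cost->>= (relabel τ attempt) (return ∘ undo) y ⟩
      cost (relabel τ attempt) y + 0             ≡⟨ +-identityʳ _ ⟩
      cost (relabel τ attempt) y                 ≡⟨ cost-relabel τ attempt y ⟩
      cost attempt (y ∘ₚ flip τ)                 ≤⟨ attempt-cost (y ∘ₚ flip τ) ⟩
      budget                                     ∎
      where open ≤-Reasoning

    codebreaker-cost : cost codebreaker y ≤ 22 * (N * L)
    codebreaker-cost = begin
      cost codebreaker y                                 ≡⟨ cost->>= attempt fallback y ⟩
      cost attempt y + cost (fallback (run attempt y)) y ≤⟨ +-mono-≤ (attempt-cost y) (fallback-cost (run attempt y)) ⟩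
      budget + budget                                    ≤⟨ budget-bound N L (s≤s z≤n) (⌈log₂⌉-mono-≤ {2} {N} (s≤s (s≤s z≤n))) ⟩
      22 * (N * L)                                       ∎
      where open ≤-Reasoning

mainTheorem1 : Σ ℕ λ C → (0 < C) × ((n : ℕ) → n ≥ 2 →
                 Σ (Strategy n) λ S → (y : Code n) →
                   (result S y ≗ᶜ y) × (queries S y ≤ C * (n * ⌈log₂ n ⌉)))
mainTheorem1 = 22 , z<s , λ where
  (suc zero) (s≤s ())
  n@(suc (suc m′)) _ → let open Codebreaker m′ in strategy codebreaker , λ y →
    subst (_≗ᶜ y) (sym (result-strategy codebreaker y)) (codebreaker-correct y) ,
    subst (_≤ 22 * (n * ⌈log₂ n ⌉)) (sym (queries-strategy codebreaker y)) (codebreaker-cost y)
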